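{- For $n\ge1$, $$\sum_{\pi\in\mathrm{PPF}(n)}x^{\mathrm{unl}(\pi)}y^{\mathrm{lel}(\pi)}=y\prod_{i=1}^{n-1}\big(xy+(i-1)x+n-1-i\big).$$
   Context: A parking function of length $n$ is a sequence $\pi=(\pi_1,\dots,\pi_n)$ of positive integers whose increasing rearrangement $b_1\le\dots\le b_n$ satisfies $b_i\le i$. It is prime if for every $1\le j\le n-1$ at least $j+1$ of the entries are $\le j$; $\mathrm{PPF}(n)$ is the set of prime parking functions of length $n$. Under the classical protocol (cars $1,\dots,n$ arrive in order, car $i$ parks in the first unoccupied spot among $\pi_i,\pi_i+1,\dots,n$), $\mathrm{unl}(\pi)$ is the number of cars not parking at their preferred spot. $\mathrm{lel}(\pi)=\#\{i:\pi_i=\pi_1\}$. -}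

module Defs where

open import Data.Bool using (Bool; true; false; _∧_; _∨_; if_then_else_)
open import Data.Nat using (ℕ; zero; suc; _+_; _*_; _∸_; _^_; _≤ᵇ_; _≡ᵇ_)
open import Data.List using (List; []; _∷_; map; concatMap; length; applyUpTo; filterᵇ; upTo)
open import Data.Nat.Properties using (≤-decTotalOrder)
open import Data.List.Sort.InsertionSort ≤-decTotalOrder using (sort)

seqs : ℕ → ℕ → List (List ℕ)
seqs zero    k = [] ∷ []
seqs (suc n) k = concatMap (λ a → map (a ∷_) (seqs n k)) (applyUpTo suc k)

countᵇ : (ℕ → Bool) → List ℕ → ℕ
countᵇ p xs = length (filterᵇ p xs)

allᵇ : {A : Set} → (A → Bool) → List A → Bool
allᵇ p []       = true
allᵇ p (x ∷ xs) = p x ∧ allᵇ p xs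

boundedFrom : ℕ → List ℕ → Bool
boundedFrom i []       = true
boundedFrom i (b ∷ bs) = (b ≤ᵇ i) ∧ boundedFrom (suc i) bs

isParkingFunction : List ℕ → Bool
isParkingFunction π = allᵇ (λ a → 1 ≤ᵇ a) π ∧ boundedFrom 1 (sort π)

isPrime : List ℕ → Bool
isPrime π = allᵇ (λ j → suc j ≤ᵇ countᵇ (λ a → a ≤ᵇ j) π) (applyUpTo suc (length π ∸ 1))

isPPF : List ℕ → Bool
isPPF π = isParkingFunction π ∧ isPrime π

-- PPF(n): entries of a parking function of length n lie in {1,…,n}
PPF : ℕ → List (List ℕ)
PPF n = filterᵇ isPPF (seqs n n)

_∈ᵇ_ : ℕ → List ℕ → Bool
s ∈ᵇ []       = false
s ∈ᵇ (t ∷ ts) = (s ≡ᵇ t) ∨ (s ∈ᵇ ts)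

-- first unoccupied spot among s, s+1, …, n (fuel bounds the search); 0 if none
firstFree : ℕ → ℕ → List ℕ → ℕ → ℕ
firstFree n zero     occ s = 0
firstFree n (suc f)  occ s =
  if s ≤ᵇ n then (if s ∈ᵇ occ then firstFree n f occ (suc s) else s) else 0

unlAux : ℕ → List ℕ → List ℕ → ℕ
unlAux n occ []       = 0
unlAux n occ (p ∷ ps) =
  let s = firstFree n (suc n) occ p in
  (if s ≡ᵇ p then 0 else 1) + unlAux n (s ∷ occ) ps

unl : List ℕ → ℕ
unl π = unlAux (length π) [] π

lel : List ℕ → ℕ
lel []        = 0
lel (p ∷ π)   = countᵇ (λ a → a ≡ᵇ p) (p ∷ π)

-- Put N = n − 1. A prime sequence has all its entries in [1, N], and on such a
-- sequence the classical protocol behaves exactly like parking on a circle of N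
-- spots: primality guarantees that each of the first N cars finds a free spot
-- between its preference and N, and for the last car only whether its preferred
-- spot is taken matters. Circular parking and lel are invariant under rotating all
-- preferences modulo N, and (cycle lemma) exactly one of the N rotations of any
-- sequence in [1, N]ⁿ is prime. So N times the left-hand side is the sum of
-- x^unl y^lel over all of [1, N]ⁿ under circular parking, which factors car by car:
-- the first car contributes y, and a car arriving when i spots are taken contributes
-- xy (the first car's spot), (i − 1)x (another taken spot) or 1 (one of N − i free spots).

module Submission where

open import Defs
open import Data.Bool using (Bool; true; false; _∧_; if_then_else_; not; T)
open import Data.Bool.Properties using (∧-zeroʳ; ¬-not)
open import Data.Empty using (⊥-elim)
open import Function using (_∘_)
open import Data.List using (List; []; _∷_; _++_; _∷ʳ_; initLast; _∷ʳ′_; map; concatMap; length; applyUpTo; filterᵇ)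
open import Data.List.Properties using (applyUpTo-∷ʳ; map-applyUpTo; length-map; length-applyUpTo; length-++)
open import Data.List.Relation.Binary.Permutation.Propositional using (_↭_)
open import Data.List.Relation.Binary.Permutation.Propositional.Properties using (↭-length; filter-↭)
open import Data.List.Relation.Unary.All as All using (All; []; _∷_)
open import Data.List.Relation.Unary.All.Properties using (applyUpTo⁺₁; applyUpTo⁻; concat⁺; map⁺)
open import Data.List.Relation.Unary.Linked using (Linked; []; [-]; _∷_)
open import Data.Nat
open import Data.Nat.Properties
open import Data.Nat.ListAction using (sum; product)
open import Algebra.Properties.CommutativeSemigroup +-commutativeSemigroup using ()
  renaming (interchange to +-interchange; xy∙z≈y∙xz to [x+y]+z≡y+[x+z]; xy∙z≈zy∙x to [x+y]+z≡[z+y]+x)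
open import Algebra.Properties.CommutativeSemigroup *-commutativeSemigroup using ()
  renaming (interchange to *-interchange; x∙yz≈y∙xz to x*[y*z]≡y*[x*z])
open import Data.Nat.Tactic.RingSolver using (solve-∀)
open import Data.List.Sort.InsertionSort ≤-decTotalOrder using (sort)
open import Data.List.Sort.InsertionSort.Properties ≤-decTotalOrder using (sort-↭; sort-↗)
open import Data.Product using (∃; _×_; _,_; proj₂)
open import Data.Sum using (_⊎_; inj₁; inj₂)
open import Data.Unit using (⊤; tt)
open import Relation.Binary.Definitions using (tri<; tri≈; tri>)
open import Relation.Binary.PropositionalEquality hiding ([_])
open import Relation.Nullary using (¬_; yes; no)

T⇒≡true : ∀ {b} → T b → b ≡ true
T⇒≡true {true} _ = refl

≡true⇒T : ∀ {b} → b ≡ true → T b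
≡true⇒T refl = tt

≤⇒≤ᵇ≡true : ∀ {m n} → m ≤ n → (m ≤ᵇ n) ≡ true
≤⇒≤ᵇ≡true m≤n = T⇒≡true (≤⇒≤ᵇ m≤n)

≤ᵇ≡true⇒≤ : ∀ {m n} → (m ≤ᵇ n) ≡ true → m ≤ n
≤ᵇ≡true⇒≤ {m} {n} e = ≤ᵇ⇒≤ m n (≡true⇒T e)

≰⇒≤ᵇ≡false : ∀ {m n} → ¬ m ≤ n → (m ≤ᵇ n) ≡ false
≰⇒≤ᵇ≡false m≰n = ¬-not (λ e → m≰n (≤ᵇ≡true⇒≤ e))

>⇒≤ᵇ≡false : ∀ {m n} → n < m → (m ≤ᵇ n) ≡ false
>⇒≤ᵇ≡false n<m = ≰⇒≤ᵇ≡false (<⇒≱ n<m)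

<⇒<ᵇ≡true : ∀ {m n} → m < n → (m <ᵇ n) ≡ true
<⇒<ᵇ≡true m<n = T⇒≡true (<⇒<ᵇ m<n)

≮⇒<ᵇ≡false : ∀ {m n} → ¬ m < n → (m <ᵇ n) ≡ false
≮⇒<ᵇ≡false {m} {n} m≮n = ¬-not (λ e → m≮n (<ᵇ⇒< m n (≡true⇒T e)))

≡ᵇ-refl : ∀ m → (m ≡ᵇ m) ≡ true
≡ᵇ-refl m = T⇒≡true (≡⇒≡ᵇ m m refl)

≡ᵇ≡true⇒≡ : ∀ {m n} → (m ≡ᵇ n) ≡ true → m ≡ n
≡ᵇ≡true⇒≡ {m} {n} e = ≡ᵇ⇒≡ m n (≡true⇒T e)

≢⇒≡ᵇ≡false : ∀ {m n} → m ≢ n → (m ≡ᵇ n) ≡ false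
≢⇒≡ᵇ≡false m≢n = ¬-not (λ e → m≢n (≡ᵇ≡true⇒≡ e))

≡ᵇ-sym : ∀ m n → (m ≡ᵇ n) ≡ (n ≡ᵇ m)
≡ᵇ-sym m n with m ≟ n
... | yes refl = refl
... | no m≢n = trans (≢⇒≡ᵇ≡false m≢n) (sym (≢⇒≡ᵇ≡false (m≢n ∘ sym)))

[_] : Bool → ℕ
[ b ] = if b then 1 else 0

[]≤1 : ∀ b → [ b ] ≤ 1
[]≤1 true = ≤-refl
[]≤1 false = z≤n

∈ᵇ-here : ∀ a xs → (a ∈ᵇ (a ∷ xs)) ≡ true
∈ᵇ-here a xs rewrite ≡ᵇ-refl a = refl

∈ᵇ-there : ∀ c a xs → (c ∈ᵇ xs) ≡ true → (c ∈ᵇ (a ∷ xs)) ≡ true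
∈ᵇ-there c a xs e rewrite e with c ≡ᵇ a
... | true = refl
... | false = refl

nonempty : ∀ {p} occ → (p ∈ᵇ occ) ≡ true → 1 ≤ length occ
nonempty (_ ∷ _) _ = s≤s z≤n

countᵇ-∷ : ∀ (p : ℕ → Bool) a xs → countᵇ p (a ∷ xs) ≡ [ p a ] + countᵇ p xs
countᵇ-∷ p a xs with p a
... | true = refl
... | false = refl

countᵇ-++ : ∀ (p : ℕ → Bool) xs ys → countᵇ p (xs ++ ys) ≡ countᵇ p xs + countᵇ p ys
countᵇ-++ p [] ys = refl
countᵇ-++ p (a ∷ xs) ys
  rewrite countᵇ-∷ p a (xs ++ ys) | countᵇ-∷ p a xs | countᵇ-++ p xs ys = sym (+-assoc [ p a ] _ _)

countᵇ≤length : ∀ (p : ℕ → Bool) xs → countᵇ p xs ≤ length xs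
countᵇ≤length p [] = z≤n
countᵇ≤length p (a ∷ xs) rewrite countᵇ-∷ p a xs = +-mono-≤ ([]≤1 (p a)) (countᵇ≤length p xs)

countᵇ-↭ : ∀ (p : ℕ → Bool) {xs ys} → xs ↭ ys → countᵇ p xs ≡ countᵇ p ys
countᵇ-↭ p xs↭ys = ↭-length (filter-↭ _ xs↭ys)

countᵇ-sort : ∀ (p : ℕ → Bool) xs → countᵇ p (sort xs) ≡ countᵇ p xs
countᵇ-sort p xs = countᵇ-↭ p (sort-↭ xs)

length-sort : ∀ xs → length (sort xs) ≡ length xs
length-sort xs = ↭-length (sort-↭ xs)

#≤ : List ℕ → ℕ → ℕ
#≤ π j = countᵇ (λ a → a ≤ᵇ j) π

∈ᵇ⇒#≤<length : ∀ c K xs → (c ∈ᵇ xs) ≡ true → K < c → #≤ xs K < length xs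
∈ᵇ⇒#≤<length c K (a ∷ xs) c∈ c>K rewrite countᵇ-∷ (_≤ᵇ K) a xs with c ≟ a
... | yes refl rewrite >⇒≤ᵇ≡false c>K = s≤s (countᵇ≤length _ xs)
... | no c≢a rewrite ≢⇒≡ᵇ≡false c≢a =
  subst (_≤ suc (length xs)) (+-suc [ a ≤ᵇ K ] _) (+-mono-≤ ([]≤1 (a ≤ᵇ K)) (∈ᵇ⇒#≤<length c K xs c∈ c>K))

#≥ : List ℕ → ℕ → ℕ
#≥ π j = countᵇ (λ b → j ≤ᵇ b) π

#≥-mono : ∀ a j xs → a ≤ j → #≥ xs j ≤ #≥ xs a
#≥-mono a j [] _ = z≤n
#≥-mono a j (b ∷ xs) a≤j rewrite countᵇ-∷ (j ≤ᵇ_) b xs | countᵇ-∷ (a ≤ᵇ_) b xs = +-mono-≤ head (#≥-mono a j xs a≤j)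
  where
  head : [ j ≤ᵇ b ] ≤ [ a ≤ᵇ b ]
  head with j ≤ᵇ b in j≤ᵇb
  ... | false = z≤n
  ... | true rewrite ≤⇒≤ᵇ≡true (≤-trans a≤j (≤ᵇ≡true⇒≤ j≤ᵇb)) = ≤-refl

#≥-self : ∀ a cars → #≥ (a ∷ cars) a ≡ suc (#≥ cars a)
#≥-self a cars rewrite countᵇ-∷ (a ≤ᵇ_) a cars | ≤⇒≤ᵇ≡true (≤-refl {a}) = refl

#≤+#≥≡length : ∀ j xs → #≤ xs j + #≥ xs (suc j) ≡ length xs
#≤+#≥≡length j [] = refl
#≤+#≥≡length j (b ∷ xs) rewrite countᵇ-∷ (_≤ᵇ j) b xs | countᵇ-∷ (suc j ≤ᵇ_) b xs with b ≤? j
... | yes b≤j rewrite ≤⇒≤ᵇ≡true b≤j | >⇒≤ᵇ≡false {suc j} {b} (s≤s b≤j) = cong suc (#≤+#≥≡length j xs)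
... | no b≰j rewrite ≰⇒≤ᵇ≡false b≰j | ≤⇒≤ᵇ≡true (≰⇒> b≰j) = trans (+-suc (#≤ xs j) _) (cong suc (#≤+#≥≡length j xs))

countᵇ-map-+ : ∀ (f : ℕ → ℕ) (p q r : ℕ → Bool) (P : ℕ → Set) c xs → All P xs →
  (∀ v → P v → [ p (f v) ] + [ q v ] ≡ [ r v ] + c) →
  countᵇ p (map f xs) + countᵇ q xs ≡ countᵇ r xs + length xs * c
countᵇ-map-+ f p q r P c [] [] h = refl
countᵇ-map-+ f p q r P c (a ∷ xs) (pa ∷ ps) h
  rewrite countᵇ-∷ p (f a) (map f xs) | countᵇ-∷ q a xs | countᵇ-∷ r a xs =
  trans (+-interchange [ p (f a) ] (countᵇ p (map f xs)) [ q a ] (countᵇ q xs))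
        (trans (cong₂ _+_ (h a pa) (countᵇ-map-+ f p q r P c xs ps h))
               (+-interchange [ r a ] c (countᵇ r xs) (length xs * c)))

m<n+1⇒m≤n : ∀ {m n} → m < n + 1 → m ≤ n
m<n+1⇒m≤n {m} {n} m<n+1 = m<1+n⇒m≤n (subst (m <_) (+-comm n 1) m<n+1)

private variable A B : Set

∑ : (A → ℕ) → List A → ℕ
∑ f xs = sum (map f xs)

∑-++ : (f : A → ℕ) (xs ys : List A) → ∑ f (xs ++ ys) ≡ ∑ f xs + ∑ f ys
∑-++ f [] ys = refl
∑-++ f (a ∷ xs) ys rewrite ∑-++ f xs ys = sym (+-assoc (f a) _ _)

∑-cong : {f g : A → ℕ} {xs : List A} → All (λ a → f a ≡ g a) xs → ∑ f xs ≡ ∑ g xs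
∑-cong [] = refl
∑-cong (e ∷ es) = cong₂ _+_ e (∑-cong es)

∑-ext : {f g : A → ℕ} (xs : List A) → (∀ a → f a ≡ g a) → ∑ f xs ≡ ∑ g xs
∑-ext [] e = refl
∑-ext (a ∷ xs) e = cong₂ _+_ (e a) (∑-ext xs e)

∑-+ : (f g : A → ℕ) (xs : List A) → ∑ (λ a → f a + g a) xs ≡ ∑ f xs + ∑ g xs
∑-+ f g [] = refl
∑-+ f g (a ∷ xs) rewrite ∑-+ f g xs = +-interchange (f a) (g a) (∑ f xs) (∑ g xs)

∑-*ˡ : (c : ℕ) (f : A → ℕ) (xs : List A) → ∑ (λ a → c * f a) xs ≡ c * ∑ f xs
∑-*ˡ c f [] = sym (*-zeroʳ c)
∑-*ˡ c f (a ∷ xs) rewrite ∑-*ˡ c f xs = sym (*-distribˡ-+ c (f a) (∑ f xs))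

∑-*ʳ : (c : ℕ) (f : A → ℕ) (xs : List A) → ∑ (λ a → f a * c) xs ≡ ∑ f xs * c
∑-*ʳ c f xs = trans (∑-ext xs (λ a → *-comm (f a) c)) (trans (∑-*ˡ c f xs) (*-comm c _))

∑-const : (c : ℕ) (xs : List A) → ∑ (λ _ → c) xs ≡ length xs * c
∑-const c [] = refl
∑-const c (a ∷ xs) = cong (c +_) (∑-const c xs)

∑-zero : (xs : List A) → ∑ (λ _ → 0) xs ≡ 0
∑-zero xs = trans (∑-const 0 xs) (*-zeroʳ (length xs))

∑-one : (xs : List A) → ∑ (λ _ → 1) xs ≡ length xs
∑-one xs = trans (∑-const 1 xs) (*-identityʳ (length xs))

∑-map : (f : B → ℕ) (g : A → B) (xs : List A) → ∑ f (map g xs) ≡ ∑ (λ a → f (g a)) xs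
∑-map f g [] = refl
∑-map f g (a ∷ xs) = cong (f (g a) +_) (∑-map f g xs)

∑-concatMap : (f : B → ℕ) (g : A → List B) (xs : List A) →
  ∑ f (concatMap g xs) ≡ ∑ (λ a → ∑ f (g a)) xs
∑-concatMap f g [] = refl
∑-concatMap f g (a ∷ xs) = trans (∑-++ f (g a) (concatMap g xs)) (cong (∑ f (g a) +_) (∑-concatMap f g xs))

∑-comm : (h : A → B → ℕ) (xs : List A) (ys : List B) →
  ∑ (λ a → ∑ (h a) ys) xs ≡ ∑ (λ b → ∑ (λ a → h a b) xs) ys
∑-comm h [] ys = sym (∑-zero ys)
∑-comm h (a ∷ xs) ys =
  trans (cong (∑ (h a) ys +_) (∑-comm h xs ys)) (sym (∑-+ (h a) (λ b → ∑ (λ a′ → h a′ b) xs) ys))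

∑-filterᵇ : (f : A → ℕ) (p : A → Bool) (xs : List A) → ∑ f (filterᵇ p xs) ≡ ∑ (λ a → if p a then f a else 0) xs
∑-filterᵇ f p [] = refl
∑-filterᵇ f p (a ∷ xs) with p a
... | true = cong (f a +_) (∑-filterᵇ f p xs)
... | false = ∑-filterᵇ f p xs

<-+-suc : ∀ {k} c K → k < suc c + K → k < c + suc K
<-+-suc {k} c K = subst (k <_) (sym (+-suc c K))

interval : ℕ → ℕ → List ℕ
interval c zero = []
interval c (suc K) = c ∷ interval (suc c) K

applyUpTo≡interval : ∀ K (f : ℕ → ℕ) c → (∀ i → f i ≡ c + i) → applyUpTo f K ≡ interval c K
applyUpTo≡interval zero f c e = refl
applyUpTo≡interval (suc K) f c e =
  cong₂ _∷_ (trans (e 0) (+-identityʳ c)) (applyUpTo≡interval K (f ∘ suc) (suc c) (λ i → trans (e (suc i)) (+-suc c i)))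

range≡interval : ∀ K → applyUpTo suc K ≡ interval 1 K
range≡interval K = applyUpTo≡interval K suc 1 (λ i → refl)

length-interval : ∀ c K → length (interval c K) ≡ K
length-interval c zero = refl
length-interval c (suc K) = cong suc (length-interval (suc c) K)

count≡-interval-below : ∀ t c K → t < c → countᵇ (λ a → a ≡ᵇ t) (interval c K) ≡ 0
count≡-interval-below t c zero t<c = refl
count≡-interval-below t c (suc K) t<c
  rewrite countᵇ-∷ (λ a → a ≡ᵇ t) c (interval (suc c) K) | ≢⇒≡ᵇ≡false {c} {t} (λ e → <⇒≢ t<c (sym e)) =
  count≡-interval-below t (suc c) K (≤-trans t<c (n≤1+n c))

count≡-interval : ∀ t c K → c ≤ t → t < c + K → countᵇ (λ a → a ≡ᵇ t) (interval c K) ≡ 1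
count≡-interval t c zero c≤t t<c+0 = ⊥-elim (<⇒≱ t<c+0 (subst (_≤ t) (sym (+-identityʳ c)) c≤t))
count≡-interval t c (suc K) c≤t t<c+K+1 rewrite countᵇ-∷ (λ a → a ≡ᵇ t) c (interval (suc c) K) with c ≟ t
... | yes refl rewrite ≡ᵇ-refl c = cong suc (count≡-interval-below c (suc c) K ≤-refl)
... | no c≢t rewrite ≢⇒≡ᵇ≡false c≢t = count≡-interval t (suc c) K (≤∧≢⇒< c≤t c≢t) (subst (t <_) (+-suc c K) t<c+K+1)

∑-agree : ∀ (F G : ℕ → ℕ) t L → countᵇ (λ a → a ≡ᵇ t) L ≡ 0 → (∀ a → a ≢ t → F a ≡ G a) → ∑ F L ≡ ∑ G L
∑-agree F G t [] c e = refl
∑-agree F G t (a ∷ L) c e with a ≟ t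
... | yes refl rewrite countᵇ-∷ (λ b → b ≡ᵇ a) a L | ≡ᵇ-refl a = ⊥-elim (1+n≢0 c)
... | no a≢t rewrite countᵇ-∷ (λ b → b ≡ᵇ t) a L | ≢⇒≡ᵇ≡false a≢t = cong₂ _+_ (e a a≢t) (∑-agree F G t L c e)

∑-update : ∀ (F G : ℕ → ℕ) t L → countᵇ (λ a → a ≡ᵇ t) L ≡ 1 → (∀ a → a ≢ t → F a ≡ G a) →
  ∑ F L + G t ≡ ∑ G L + F t
∑-update F G t [] () e
∑-update F G t (a ∷ L) c e with a ≟ t
... | yes refl rewrite countᵇ-∷ (λ b → b ≡ᵇ a) a L | ≡ᵇ-refl a | ∑-agree F G a L (suc-injective c) e =
  [x+y]+z≡[z+y]+x (F a) (∑ G L) (G a)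
... | no a≢t rewrite countᵇ-∷ (λ b → b ≡ᵇ t) a L | ≢⇒≡ᵇ≡false a≢t | e a a≢t =
  trans (+-assoc (G a) _ _) (trans (cong (G a +_) (∑-update F G t L c e)) (sym (+-assoc (G a) _ _)))

Distinct : List ℕ → Set
Distinct [] = ⊤
Distinct (t ∷ occ) = (t ∈ᵇ occ) ≡ false × Distinct occ

∑-select : ∀ (h k : ℕ → ℕ) L occ → Distinct occ → All (λ t → countᵇ (λ a → a ≡ᵇ t) L ≡ 1) occ →
  ∑ (λ a → if a ∈ᵇ occ then h a else k a) L + ∑ k occ ≡ ∑ h occ + ∑ k L
∑-select h k L [] _ [] = +-identityʳ _
∑-select h k L (t ∷ occ) (t∉occ , d) (once ∷ onces) = begin
  ∑ F₁ L + (k t + ∑ k occ)   ≡⟨ +-assoc (∑ F₁ L) (k t) _ ⟨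
  ∑ F₁ L + k t + ∑ k occ     ≡⟨ cong (_+ ∑ k occ) update ⟩
  ∑ F₀ L + h t + ∑ k occ     ≡⟨ [x+y]+z≡y+[x+z] (∑ F₀ L) (h t) (∑ k occ) ⟩
  h t + (∑ F₀ L + ∑ k occ)   ≡⟨ cong (h t +_) (∑-select h k L occ d onces) ⟩
  h t + (∑ h occ + ∑ k L)    ≡⟨ +-assoc (h t) _ _ ⟨
  h t + ∑ h occ + ∑ k L      ∎
  where
  open ≡-Reasoning
  F₁ F₀ : ℕ → ℕ
  F₁ a = if a ∈ᵇ (t ∷ occ) then h a else k a
  F₀ a = if a ∈ᵇ occ then h a else k a
  F₀t : F₀ t ≡ k t
  F₀t rewrite t∉occ = refl
  F₁t : F₁ t ≡ h t
  F₁t rewrite ≡ᵇ-refl t = refl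
  agree : ∀ a → a ≢ t → F₁ a ≡ F₀ a
  agree a a≢t rewrite ≢⇒≡ᵇ≡false a≢t = refl
  update : ∑ F₁ L + k t ≡ ∑ F₀ L + h t
  update = trans (cong (∑ F₁ L +_) (sym F₀t)) (trans (∑-update F₁ F₀ t L once agree) (cong (∑ F₀ L +_) F₁t))

∑[]<length⇒false : ∀ (q : ℕ → Bool) {P : ℕ → Set} L → All P L → ∑ (λ a → [ q a ]) L < length L →
  ∃ λ a → P a × q a ≡ false
∑[]<length⇒false q (a ∷ L) (pa ∷ ps) lt with q a in qa
... | false = a , pa , qa
... | true = ∑[]<length⇒false q L ps (≤-pred lt)

∑-interval-false : ∀ (b : ℕ → Bool) c K → (∀ k → c ≤ k → k < c + K → b k ≡ false) → ∑ (λ k → [ b k ]) (interval c K) ≡ 0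
∑-interval-false b c zero _ = refl
∑-interval-false b c (suc K) h rewrite h c ≤-refl (<-+-suc c K (s≤s (m≤m+n c K))) =
  ∑-interval-false b (suc c) K (λ k c<k k<c+1+K → h k (<⇒≤ c<k) (<-+-suc c K k<c+1+K))

∑-interval-unique : ∀ (b : ℕ → Bool) c K → (∃ λ k → c ≤ k × k < c + K × b k ≡ true) →
  (∀ k k′ → k < c + K → k′ < c + K → c ≤ k → c ≤ k′ → b k ≡ true → b k′ ≡ true → k ≡ k′) →
  ∑ (λ k → [ b k ]) (interval c K) ≡ 1
∑-interval-unique b c zero (k , c≤k , k<c+0 , _) _ = ⊥-elim (<⇒≱ k<c+0 (subst (_≤ k) (sym (+-identityʳ c)) c≤k))
∑-interval-unique b c (suc K) (k , c≤k , k<c+K , bk) unique with b c in bc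
... | true = cong suc (∑-interval-false b (suc c) K (λ k c<k k<c+1+K → ¬-not (λ bk′ →
      <⇒≢ c<k (unique c k (<-+-suc c K (s≤s (m≤m+n c K))) (<-+-suc c K k<c+1+K) ≤-refl (<⇒≤ c<k) bc bk′))))
... | false = ∑-interval-unique b (suc c) K (k , ≤∧≢⇒< c≤k c≢k , subst (k <_) (+-suc c K) k<c+K , bk)
               (λ k k′ k< k′< c<k c<k′ → unique k k′ (<-+-suc c K k<) (<-+-suc c K k′<) (<⇒≤ c<k) (<⇒≤ c<k′))
  where
  c≢k : c ≢ k
  c≢k refl with () ← trans (sym bc) bk

InRange : ℕ → ℕ → Set
InRange K a = 1 ≤ a × a ≤ K

range-InRange : ∀ K → All (InRange K) (applyUpTo suc K)
range-InRange K = applyUpTo⁺₁ suc K (λ i<K → s≤s z≤n , i<K)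

∑-range-cong : ∀ K {f g : ℕ → ℕ} → (∀ a → InRange K a → f a ≡ g a) →
  ∑ f (applyUpTo suc K) ≡ ∑ g (applyUpTo suc K)
∑-range-cong K e = ∑-cong (All.map (λ {a} → e a) (range-InRange K))

seqs-InRange : ∀ m K → All (λ π → All (InRange K) π × length π ≡ m) (seqs m K)
seqs-InRange zero K = ([] , refl) ∷ []
seqs-InRange (suc m) K = concat⁺ (map⁺ (All.map extend (range-InRange K)))
  where
  extend : ∀ {a} → InRange K a → All (λ π → All (InRange K) π × length π ≡ suc m) (map (a ∷_) (seqs m K))
  extend ra = map⁺ (All.map (λ (r , l) → ra ∷ r , cong suc l) (seqs-InRange m K))

∑-seqs-cong : ∀ m K {f g : List ℕ → ℕ} → (∀ π → All (InRange K) π → length π ≡ m → f π ≡ g π) →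
  ∑ f (seqs m K) ≡ ∑ g (seqs m K)
∑-seqs-cong m K e = ∑-cong (All.map (λ {π} (r , l) → e π r l) (seqs-InRange m K))

∑-seqs-suc : ∀ (f : List ℕ → ℕ) m K →
  ∑ f (seqs (suc m) K) ≡ ∑ (λ a → ∑ (λ π → f (a ∷ π)) (seqs m K)) (applyUpTo suc K)
∑-seqs-suc f m K = trans (∑-concatMap f (λ a → map (a ∷_) (seqs m K)) (applyUpTo suc K))
  (∑-ext (applyUpTo suc K) (λ a → ∑-map f (a ∷_) (seqs m K)))

∑-seqs-restrict : ∀ m K (f : List ℕ → ℕ) → (∀ π → length π ≡ m → (suc K ∈ᵇ π) ≡ true → f π ≡ 0) →
  ∑ f (seqs m (suc K)) ≡ ∑ f (seqs m K)
∑-seqs-restrict zero K f e = refl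
∑-seqs-restrict (suc m) K f e = begin
  ∑ f (seqs (suc m) (suc K))                          ≡⟨ ∑-seqs-suc f m (suc K) ⟩
  ∑ H (applyUpTo suc (suc K))                         ≡⟨ cong (∑ H) (applyUpTo-∷ʳ suc K) ⟨
  ∑ H (applyUpTo suc K ++ suc K ∷ [])                 ≡⟨ ∑-++ H (applyUpTo suc K) (suc K ∷ []) ⟩
  ∑ H (applyUpTo suc K) + (H (suc K) + 0)             ≡⟨ cong (λ z → ∑ H (applyUpTo suc K) + (z + 0)) H[K+1]≡0 ⟩
  ∑ H (applyUpTo suc K) + 0                           ≡⟨ +-identityʳ _ ⟩
  ∑ H (applyUpTo suc K)                               ≡⟨ ∑-ext (applyUpTo suc K) restrict-tail ⟩
  ∑ (λ a → ∑ (λ π → f (a ∷ π)) (seqs m K)) (applyUpTo suc K) ≡⟨ ∑-seqs-suc f m K ⟨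
  ∑ f (seqs (suc m) K)                                ∎
  where
  open ≡-Reasoning
  H : ℕ → ℕ
  H a = ∑ (λ π → f (a ∷ π)) (seqs m (suc K))
  H[K+1]≡0 : H (suc K) ≡ 0
  H[K+1]≡0 = trans (∑-seqs-cong m (suc K) (λ π _ l → e (suc K ∷ π) (cong suc l) (∈ᵇ-here (suc K) π)))
                   (∑-zero (seqs m (suc K)))
  restrict-tail : ∀ a → H a ≡ ∑ (λ π → f (a ∷ π)) (seqs m K)
  restrict-tail a = ∑-seqs-restrict m K (λ π → f (a ∷ π)) (λ π l c → e (a ∷ π) (cong suc l) (∈ᵇ-there (suc K) a π c))

allᵇ⇒All : ∀ (p : ℕ → Bool) xs → allᵇ p xs ≡ true → All (λ a → p a ≡ true) xs
allᵇ⇒All p [] e = []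
allᵇ⇒All p (a ∷ xs) e with p a in pa
... | true = pa ∷ allᵇ⇒All p xs e

All⇒allᵇ : ∀ (p : ℕ → Bool) {xs} → All (λ a → p a ≡ true) xs → allᵇ p xs ≡ true
All⇒allᵇ p [] = refl
All⇒allᵇ p (e ∷ es) rewrite e = All⇒allᵇ p es

PrimeCounts : ℕ → List ℕ → Set
PrimeCounts N π = ∀ j → 1 ≤ j → j ≤ N → suc j ≤ #≤ π j

isPrime⇒PrimeCounts : ∀ N π → length π ≡ suc N → isPrime π ≡ true → PrimeCounts N π
isPrime⇒PrimeCounts N π l e (suc j) _ j<N =
  ≤ᵇ≡true⇒≤ (applyUpTo⁻ suc (length π ∸ 1) (allᵇ⇒All _ _ e) (subst (λ z → j < z ∸ 1) (sym l) j<N))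

PrimeCounts⇒isPrime : ∀ N π → length π ≡ suc N → PrimeCounts N π → isPrime π ≡ true
PrimeCounts⇒isPrime N π l P = All⇒allᵇ _ (applyUpTo⁺₁ suc (length π ∸ 1)
  (λ {i} i<len → ≤⇒≤ᵇ≡true (P (suc i) (s≤s z≤n) (subst (i <_) (cong (_∸ 1) l) i<len))))

#≤-all : ∀ π K → All (_≤ K) π → #≤ π K ≡ length π
#≤-all [] K [] = refl
#≤-all (a ∷ π) K (a≤K ∷ ps) rewrite countᵇ-∷ (λ b → b ≤ᵇ K) a π | ≤⇒≤ᵇ≡true a≤K = cong suc (#≤-all π K ps)

sorted-head≤ : ∀ b cs i → Linked _≤_ (b ∷ cs) → 1 ≤ #≤ (b ∷ cs) i → b ≤ i
sorted-head≤ b cs i L h with b ≤ᵇ i in eq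
... | true = ≤ᵇ≡true⇒≤ eq
sorted-head≤ b [] i L () | false
sorted-head≤ b (c ∷ cs) i (b≤c ∷ L) h | false = ≤-trans b≤c (sorted-head≤ c cs i L h)

boundedFrom-sorted : ∀ bs i → Linked _≤_ bs → (∀ d → d < length bs → suc d ≤ #≤ bs (i + d)) →
  boundedFrom i bs ≡ true
boundedFrom-sorted [] i L H = refl
boundedFrom-sorted (b ∷ cs) i L H =
  subst (λ z → z ∧ boundedFrom (suc i) cs ≡ true) (sym (≤⇒≤ᵇ≡true b≤i)) (boundedFrom-sorted cs (suc i) (tail L) H′)
  where
  b≤i : b ≤ i
  b≤i = sorted-head≤ b cs i L (subst (λ z → 1 ≤ #≤ (b ∷ cs) z) (+-identityʳ i) (H 0 (s≤s z≤n)))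
  tail : ∀ {xs} → Linked _≤_ (b ∷ xs) → Linked _≤_ xs
  tail [-] = []
  tail (_ ∷ l) = l
  #≤-cons : ∀ d → #≤ (b ∷ cs) (i + suc d) ≡ 1 + #≤ cs (suc i + d)
  #≤-cons d rewrite countᵇ-∷ (λ a → a ≤ᵇ (i + suc d)) b cs | ≤⇒≤ᵇ≡true (≤-trans b≤i (m≤m+n i (suc d))) | +-suc i d = refl
  H′ : ∀ d → d < length cs → suc d ≤ #≤ cs (suc i + d)
  H′ d d<len = +-cancelˡ-≤ 1 _ _ (subst (2 + d ≤_) (#≤-cons d) (H (suc d) (s≤s d<len)))

allᵇ-positive : ∀ N π → All (InRange N) π → allᵇ (λ a → 1 ≤ᵇ a) π ≡ true
allᵇ-positive N π r = All⇒allᵇ _ (All.map (λ (1≤a , _) → ≤⇒≤ᵇ≡true 1≤a) r)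

prime⇒parking : ∀ N π → All (InRange N) π → length π ≡ suc N → isPrime π ≡ true → isParkingFunction π ≡ true
prime⇒parking N π r l e rewrite allᵇ-positive N π r = boundedFrom-sorted (sort π) 1 (sort-↗ π) counts
  where
  counts : ∀ d → d < length (sort π) → suc d ≤ #≤ (sort π) (suc d)
  counts d d<len rewrite countᵇ-sort (λ a → a ≤ᵇ suc d) π with d <? N
  ... | yes d<N = ≤-trans (n≤1+n _) (isPrime⇒PrimeCounts N π l e (suc d) (s≤s z≤n) d<N)
  ... | no d≮N = subst (suc d ≤_) (sym (#≤-all π (suc d) (All.map (λ (_ , a≤N) → ≤-trans a≤N (≤-trans (≮⇒≥ d≮N) (n≤1+n d))) r)))
                   (subst (suc d ≤_) (length-sort π) d<len)

-- m is the last minimiser of i ↦ c i − i over i < L, stated without subtraction.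
LastArgmin : (ℕ → ℕ) → ℕ → ℕ → Set
LastArgmin c L m = (∀ i → i ≤ m → c m + i ≤ c i + m) × (∀ t → m < t → t < L → c m + t < c t + m)

lastArgmin-unique : ∀ c L {m m′} → m < L → m′ < L → LastArgmin c L m → LastArgmin c L m′ → m ≡ m′
lastArgmin-unique c L {m} {m′} m<L m′<L (min , after) (min′ , after′) with <-cmp m m′
... | tri< m<m′ _ _ = ⊥-elim (<⇒≱ (after m′ m<m′ m′<L) (min′ m (<⇒≤ m<m′)))
... | tri≈ _ m≡m′ _ = m≡m′
... | tri> _ _ m′<m = ⊥-elim (<⇒≱ (after′ m m′<m m<L) (min m′ (<⇒≤ m′<m)))

lastArgmin-exists : ∀ c L → 1 ≤ L → ∃ λ m → m < L × LastArgmin c L m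
lastArgmin-exists c (suc zero) _ = 0 , s≤s z≤n , (λ { zero _ → ≤-refl }) , (λ t 0<t t<1 → ⊥-elim (<⇒≱ 0<t (≤-pred t<1)))
lastArgmin-exists c (suc (suc L′)) _ with lastArgmin-exists c (suc L′) (s≤s z≤n)
... | m , m<L , (min , after) with c (suc L′) + m ≤? c m + suc L′
...   | yes new = suc L′ , ≤-refl , min-L , (λ t L<t t<L+1 → ⊥-elim (<⇒≱ L<t (≤-pred t<L+1)))
  where
  L = suc L′
  chain : ∀ {i} → c m + i ≤ c i + m → c L + i ≤ c i + L
  chain {i} old = +-cancelʳ-≤ (c m + m) _ _ (subst₂ _≤_ (lhs (c L) m (c m) i) (rhs (c m) L (c i) m) (+-mono-≤ new old))
    where
    lhs : ∀ cL m c₁ i → (cL + m) + (c₁ + i) ≡ (cL + i) + (c₁ + m)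
    lhs = solve-∀
    rhs : ∀ c₁ L ci m → (c₁ + L) + (ci + m) ≡ (ci + L) + (c₁ + m)
    rhs = solve-∀
  min-L : ∀ i → i ≤ L → c L + i ≤ c i + L
  min-L i i≤L with i ≤? m
  ... | yes i≤m = chain (min i i≤m)
  ... | no i≰m with m≤n⇒m<n∨m≡n i≤L
  ...   | inj₂ refl = ≤-refl
  ...   | inj₁ i<L = chain (<⇒≤ (after i (≰⇒> i≰m) i<L))
...   | no old = m , ≤-trans m<L (n≤1+n _) , min , after-L
  where
  after-L : ∀ t → m < t → t < suc (suc L′) → c m + t < c t + m
  after-L t m<t t<L+1 with m≤n⇒m<n∨m≡n (≤-pred t<L+1)
  ... | inj₁ t<L = after t m<t t<L
  ... | inj₂ refl = ≰⇒> old

firstFree-≥ : ∀ M f occ q → firstFree M f occ q ≡ 0 ⊎ q ≤ firstFree M f occ q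
firstFree-≥ M zero occ q = inj₁ refl
firstFree-≥ M (suc f) occ q with q ≤ᵇ M
... | false = inj₁ refl
... | true with q ∈ᵇ occ
...   | false = inj₂ ≤-refl
...   | true with firstFree-≥ M f occ (suc q)
...     | inj₁ e = inj₁ e
...     | inj₂ q<ff = inj₂ (<⇒≤ q<ff)

firstFree-misses : ∀ M f occ p → 1 ≤ p → p ≤ M → (if firstFree M (suc f) occ p ≡ᵇ p then 0 else 1) ≡ [ p ∈ᵇ occ ]
firstFree-misses M f occ p 1≤p p≤M rewrite ≤⇒≤ᵇ≡true p≤M with p ∈ᵇ occ
... | false rewrite ≡ᵇ-refl p = refl
... | true = cong (if_then 0 else 1) (≢⇒≡ᵇ≡false moves)
  where
  moves : firstFree M f occ (suc p) ≢ p
  moves e with firstFree-≥ M f occ (suc p)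
  ... | inj₁ ff≡0 = 1+n≰n (subst (1 ≤_) (trans (sym e) ff≡0) 1≤p)
  ... | inj₂ p<ff = 1+n≰n (subst (suc p ≤_) e p<ff)

module Parking (N′ : ℕ) where

  N : ℕ
  N = suc N′

  next : ℕ → ℕ
  next v = if v <ᵇ N then suc v else 1

  rotate : ℕ → ℕ → ℕ
  rotate zero v = v
  rotate (suc k) v = next (rotate k v)

  next-< : ∀ v → v < N → next v ≡ suc v
  next-< v v<N rewrite <⇒<ᵇ≡true v<N = refl

  next-N : next N ≡ 1
  next-N rewrite ≮⇒<ᵇ≡false (n≮n N) = refl

  next-InRange : ∀ {v} → InRange N v → InRange N (next v)
  next-InRange {v} (_ , v≤N) with v <? N
  ... | yes v<N rewrite <⇒<ᵇ≡true v<N = s≤s z≤n , v<N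
  ... | no v≮N rewrite ≮⇒<ᵇ≡false v≮N = s≤s z≤n , s≤s z≤n

  rotate-InRange : ∀ k {v} → InRange N v → InRange N (rotate k v)
  rotate-InRange zero r = r
  rotate-InRange (suc k) r = next-InRange (rotate-InRange k r)

  rotate-next : ∀ k v → rotate k (next v) ≡ next (rotate k v)
  rotate-next zero v = refl
  rotate-next (suc k) v = cong next (rotate-next k v)

  next-injective : ∀ {u v} → InRange N u → InRange N v → next u ≡ next v → u ≡ v
  next-injective {u} {v} (1≤u , u≤N) (1≤v , v≤N) e with u <? N | v <? N
  ... | yes u<N | yes v<N rewrite <⇒<ᵇ≡true u<N | <⇒<ᵇ≡true v<N = suc-injective e
  ... | no u≮N  | no v≮N  = trans (≤∧≮⇒≡ u≤N u≮N) (sym (≤∧≮⇒≡ v≤N v≮N))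
  ... | yes u<N | no v≮N  rewrite <⇒<ᵇ≡true u<N | ≮⇒<ᵇ≡false v≮N = ⊥-elim (1+n≰n (subst (1 ≤_) (suc-injective e) 1≤u))
  ... | no u≮N  | yes v<N rewrite ≮⇒<ᵇ≡false u≮N | <⇒<ᵇ≡true v<N = ⊥-elim (1+n≰n (subst (1 ≤_) (sym (suc-injective e)) 1≤v))

  rotate-injective : ∀ k {u v} → InRange N u → InRange N v → rotate k u ≡ rotate k v → u ≡ v
  rotate-injective zero ru rv e = e
  rotate-injective (suc k) ru rv e = rotate-injective k ru rv (next-injective (rotate-InRange k ru) (rotate-InRange k rv) e)

  rotate-wrap : ∀ k m → m + k ≡ N → ∀ v → InRange N v → rotate k v ≡ (if v ≤ᵇ m then v + k else v ∸ m)
  rotate-wrap zero m e v (_ , v≤N)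
    rewrite ≤⇒≤ᵇ≡true (subst (v ≤_) (trans (sym e) (+-identityʳ m)) v≤N) = sym (+-identityʳ v)
  rotate-wrap (suc k) m e v (1≤v , v≤N) rewrite rotate-wrap k (suc m) (trans (sym (+-suc m k)) e) v (1≤v , v≤N) with v ≤? m
  ... | yes v≤m rewrite ≤⇒≤ᵇ≡true v≤m | ≤⇒≤ᵇ≡true (≤-trans v≤m (n≤1+n m)) =
    trans (next-< (v + k) (subst (v + k <_) e (≤-trans (s≤s (+-monoˡ-≤ k v≤m)) (≤-reflexive (sym (+-suc m k)))))) (sym (+-suc v k))
  ... | no v≰m rewrite ≰⇒≤ᵇ≡false v≰m with v ≤? suc m
  ...   | yes v≤m+1 rewrite ≤⇒≤ᵇ≡true v≤m+1 | ≤∧≮⇒≡ v≤m+1 (λ v<m+1 → v≰m (≤-pred v<m+1)) =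
    trans (cong next (trans (sym (+-suc m k)) e)) (trans next-N (sym (m+n∸n≡m 1 m)))
  ...   | no v≰m+1 rewrite ≰⇒≤ᵇ≡false v≰m+1 =
    trans (next-< (v ∸ suc m) (≤-trans (s≤s (∸-monoʳ-≤ {1} {suc m} v (s≤s z≤n))) (subst (_≤ N) (+-∸-assoc 1 1≤v) v≤N)))
          (sym (+-∸-assoc 1 (≰⇒> v≰m)))

  ≡ᵇ-rotate : ∀ k {a t} → InRange N a → InRange N t → (rotate k a ≡ᵇ rotate k t) ≡ (a ≡ᵇ t)
  ≡ᵇ-rotate k {a} {t} ra rt with a ≟ t
  ... | yes refl rewrite ≡ᵇ-refl (rotate k a) | ≡ᵇ-refl a = refl
  ... | no a≢t rewrite ≢⇒≡ᵇ≡false a≢t = ≢⇒≡ᵇ≡false (λ e → a≢t (rotate-injective k ra rt e))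

  ∈ᵇ-rotate : ∀ k a occ → InRange N a → All (InRange N) occ → (rotate k a ∈ᵇ map (rotate k) occ) ≡ (a ∈ᵇ occ)
  ∈ᵇ-rotate k a [] ra [] = refl
  ∈ᵇ-rotate k a (t ∷ occ) ra (rt ∷ ro) rewrite ≡ᵇ-rotate k ra rt | ∈ᵇ-rotate k a occ ra ro = refl

  parkCirc : List ℕ → ℕ → ℕ → ℕ
  parkCirc occ p zero = p
  parkCirc occ p (suc f) = if p ∈ᵇ occ then parkCirc occ (next p) f else p

  -- With N + 1 cars the last one finds no free spot and parkCirc returns an occupied
  -- one; this is harmless, since only whether its preferred spot is taken is counted.
  unlCirc : List ℕ → List ℕ → ℕ
  unlCirc occ [] = 0
  unlCirc occ (p ∷ ps) = [ p ∈ᵇ occ ] + unlCirc (parkCirc occ p N ∷ occ) ps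

  parkCirc-InRange : ∀ occ p f → InRange N p → InRange N (parkCirc occ p f)
  parkCirc-InRange occ p zero r = r
  parkCirc-InRange occ p (suc f) r with p ∈ᵇ occ
  ... | true = parkCirc-InRange occ (next p) f (next-InRange r)
  ... | false = r

  parkCirc-rotate : ∀ k occ p f → InRange N p → All (InRange N) occ →
    parkCirc (map (rotate k) occ) (rotate k p) f ≡ rotate k (parkCirc occ p f)
  parkCirc-rotate k occ p zero rp ro = refl
  parkCirc-rotate k occ p (suc f) rp ro rewrite ∈ᵇ-rotate k p occ rp ro with p ∈ᵇ occ
  ... | true = trans (cong (λ z → parkCirc (map (rotate k) occ) z f) (sym (rotate-next k p)))
                     (parkCirc-rotate k occ (next p) f (next-InRange rp) ro)
  ... | false = refl

  unlCirc-rotate : ∀ k occ ps → All (InRange N) occ → All (InRange N) ps →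
    unlCirc (map (rotate k) occ) (map (rotate k) ps) ≡ unlCirc occ ps
  unlCirc-rotate k occ [] ro [] = refl
  unlCirc-rotate k occ (p ∷ ps) ro (rp ∷ rps) = cong₂ _+_ (cong [_] (∈ᵇ-rotate k p occ rp ro))
    (trans (cong (λ z → unlCirc (z ∷ map (rotate k) occ) (map (rotate k) ps)) (parkCirc-rotate k occ p N rp ro))
           (unlCirc-rotate k (parkCirc occ p N ∷ occ) ps (parkCirc-InRange occ p N rp ∷ ro) rps))

  count≡-rotate : ∀ k p ps → InRange N p → All (InRange N) ps →
    countᵇ (λ a → a ≡ᵇ rotate k p) (map (rotate k) ps) ≡ countᵇ (λ a → a ≡ᵇ p) ps
  count≡-rotate k p [] rp [] = refl
  count≡-rotate k p (q ∷ ps) rp (rq ∷ rps)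
    rewrite countᵇ-∷ (λ a → a ≡ᵇ rotate k p) (rotate k q) (map (rotate k) ps)
          | countᵇ-∷ (λ a → a ≡ᵇ p) q ps | ≡ᵇ-rotate k rq rp = cong ([ q ≡ᵇ p ] +_) (count≡-rotate k p ps rp rps)

  lel-rotate : ∀ k π → All (InRange N) π → lel (map (rotate k) π) ≡ lel π
  lel-rotate k [] [] = refl
  lel-rotate k (p ∷ ps) (rp ∷ rps)
    rewrite ≡ᵇ-refl (rotate k p) | ≡ᵇ-refl p = cong suc (count≡-rotate k p ps rp rps)

  ∑-range-next : (g : ℕ → ℕ) → ∑ (λ a → g (next a)) (applyUpTo suc N) ≡ ∑ g (applyUpTo suc N)
  ∑-range-next g = begin
    ∑ (g ∘ next) (applyUpTo suc N)                   ≡⟨ cong (∑ (g ∘ next)) (applyUpTo-∷ʳ suc N′) ⟨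
    ∑ (g ∘ next) (applyUpTo suc N′ ++ N ∷ [])        ≡⟨ ∑-++ (g ∘ next) (applyUpTo suc N′) (N ∷ []) ⟩
    ∑ (g ∘ next) (applyUpTo suc N′) + (g (next N) + 0)
      ≡⟨ cong₂ (λ u v → u + (g v + 0)) (∑-range-cong N′ (λ a (_ , a≤N′) → cong g (next-< a (s≤s a≤N′)))) next-N ⟩
    ∑ (g ∘ suc) (applyUpTo suc N′) + (g 1 + 0)       ≡⟨ cong (∑ (g ∘ suc) (applyUpTo suc N′) +_) (+-identityʳ (g 1)) ⟩
    ∑ (g ∘ suc) (applyUpTo suc N′) + g 1             ≡⟨ +-comm _ (g 1) ⟩
    g 1 + ∑ (g ∘ suc) (applyUpTo suc N′)             ≡⟨ cong (g 1 +_) (∑-map g suc (applyUpTo suc N′)) ⟨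
    g 1 + ∑ g (map suc (applyUpTo suc N′))           ≡⟨ cong (λ z → g 1 + ∑ g z) (map-applyUpTo suc suc N′) ⟩
    ∑ g (applyUpTo suc N)                            ∎
    where open ≡-Reasoning

  ∑-range-rotate : ∀ k (g : ℕ → ℕ) → ∑ (λ a → g (rotate k a)) (applyUpTo suc N) ≡ ∑ g (applyUpTo suc N)
  ∑-range-rotate zero g = refl
  ∑-range-rotate (suc k) g = trans (∑-ext (applyUpTo suc N) (λ a → cong g (sym (rotate-next k a))))
                                   (trans (∑-range-next (λ a → g (rotate k a))) (∑-range-rotate k g))

  ∑-seqs-rotate : ∀ k m (f : List ℕ → ℕ) → ∑ (λ π → f (map (rotate k) π)) (seqs m N) ≡ ∑ f (seqs m N)
  ∑-seqs-rotate k zero f = refl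
  ∑-seqs-rotate k (suc m) f = begin
    ∑ (λ π → f (map (rotate k) π)) (seqs (suc m) N)                                   ≡⟨ ∑-seqs-suc _ m N ⟩
    ∑ (λ a → ∑ (λ π → f (rotate k a ∷ map (rotate k) π)) (seqs m N)) (applyUpTo suc N)
      ≡⟨ ∑-ext (applyUpTo suc N) (λ a → ∑-seqs-rotate k m (λ π → f (rotate k a ∷ π))) ⟩
    ∑ (λ a → ∑ (λ π → f (rotate k a ∷ π)) (seqs m N)) (applyUpTo suc N)
      ≡⟨ ∑-range-rotate k (λ b → ∑ (λ π → f (b ∷ π)) (seqs m N)) ⟩
    ∑ (λ a → ∑ (λ π → f (a ∷ π)) (seqs m N)) (applyUpTo suc N)                        ≡⟨ ∑-seqs-suc f m N ⟨
    ∑ f (seqs (suc m) N)                                                              ∎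
    where open ≡-Reasoning

  count≡-range : ∀ t → InRange N t → countᵇ (λ a → a ≡ᵇ t) (interval 1 N) ≡ 1
  count≡-range t (1≤t , t≤N) = count≡-interval t 1 N 1≤t (s≤s t≤N)

  ∑-occupied : ∀ occ → Distinct occ → All (InRange N) occ → ∑ (λ a → [ a ∈ᵇ occ ]) (interval 1 N) ≡ length occ
  ∑-occupied occ d r = +-cancelʳ-≡ 0 _ _ (begin
    ∑ (λ a → [ a ∈ᵇ occ ]) (interval 1 N) + 0                   ≡⟨ cong (∑ (λ a → [ a ∈ᵇ occ ]) (interval 1 N) +_) (∑-zero occ) ⟨
    ∑ (λ a → [ a ∈ᵇ occ ]) (interval 1 N) + ∑ (λ _ → 0) occ   ≡⟨ ∑-select (λ _ → 1) (λ _ → 0) (interval 1 N) occ d (All.map (λ {t} → count≡-range t) r) ⟩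
    ∑ (λ _ → 1) occ + ∑ (λ _ → 0) (interval 1 N)              ≡⟨ cong₂ _+_ (∑-one occ) (∑-zero (interval 1 N)) ⟩
    length occ + 0                                            ∎)
    where open ≡-Reasoning

  free-spot : ∀ occ → Distinct occ → All (InRange N) occ → length occ < N → ∃ λ t → InRange N t × (t ∈ᵇ occ) ≡ false
  free-spot occ d r lt = ∑[]<length⇒false (_∈ᵇ occ) (interval 1 N)
    (subst (All (InRange N)) (range≡interval N) (range-InRange N))
    (subst₂ _<_ (sym (∑-occupied occ d r)) (sym (length-interval 1 N)) lt)

  rotate-reaches : ∀ p t → InRange N p → InRange N t → ∃ λ d → d < N × rotate d p ≡ t
  rotate-reaches p t rp@(1≤p , p≤N) (1≤t , t≤N) with p ≤? t
  ... | yes p≤t = d , d<N , (begin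
    rotate d p                                     ≡⟨ rotate-wrap d (N ∸ d) (m∸n+n≡m (<⇒≤ d<N)) p rp ⟩
    (if p ≤ᵇ N ∸ d then p + d else p ∸ (N ∸ d))    ≡⟨ cong (if_then p + d else p ∸ (N ∸ d)) (≤⇒≤ᵇ≡true p≤N∸d) ⟩
    p + d                                          ≡⟨ p+d≡t ⟩
    t                                              ∎)
    where
    open ≡-Reasoning
    d : ℕ
    d = t ∸ p
    p+d≡t : p + d ≡ t
    p+d≡t = m+[n∸m]≡n p≤t
    d<N : d < N
    d<N = ≤-trans (+-monoˡ-≤ d 1≤p) (≤-trans (≤-reflexive p+d≡t) t≤N)
    p≤N∸d : p ≤ N ∸ d
    p≤N∸d = m+n≤o⇒m≤o∸n p (subst (_≤ N) (sym p+d≡t) t≤N)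
  ... | no p≰t = N ∸ m , ∸-monoʳ-< (m<n⇒0<n∸m t<p) m≤N , (begin
    rotate (N ∸ m) p                               ≡⟨ rotate-wrap (N ∸ m) m (m+[n∸m]≡n m≤N) p rp ⟩
    (if p ≤ᵇ m then p + (N ∸ m) else p ∸ m)        ≡⟨ cong (if_then p + (N ∸ m) else p ∸ m) (>⇒≤ᵇ≡false m<p) ⟩
    p ∸ m                                          ≡⟨ m∸[m∸n]≡n (<⇒≤ t<p) ⟩
    t                                              ∎)
    where
    open ≡-Reasoning
    t<p : t < p
    t<p = ≰⇒> p≰t
    m : ℕ
    m = p ∸ t
    m≤N : m ≤ N
    m≤N = ≤-trans (m∸n≤m p t) p≤N
    m<p : m < p
    m<p = ∸-monoʳ-< {p} {t} {0} 1≤t (<⇒≤ t<p)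

  parkCirc-finds : ∀ d p f occ → d < f → (rotate d p ∈ᵇ occ) ≡ false → (parkCirc occ p f ∈ᵇ occ) ≡ false
  parkCirc-finds zero p (suc f) occ _ e rewrite e = e
  parkCirc-finds (suc d) p (suc f) occ (s≤s d<f) e with p ∈ᵇ occ in p∈occ
  ... | true = parkCirc-finds d (next p) f occ d<f (trans (cong (_∈ᵇ occ) (rotate-next d p)) e)
  ... | false = p∈occ

  parkCirc-free : ∀ occ p → InRange N p → (∃ λ t → InRange N t × (t ∈ᵇ occ) ≡ false) → (parkCirc occ p N ∈ᵇ occ) ≡ false
  parkCirc-free occ p rp (t , rt , t∉occ) with rotate-reaches p t rp rt
  ... | d , d<N , reaches = parkCirc-finds d p N occ d<N (trans (cong (_∈ᵇ occ) reaches) t∉occ)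

  module Weights (x y : ℕ) where

    factor : ℕ → ℕ
    factor i = x * y + (i ∸ 1) * x + (N ∸ i)

    -- occ lists the taken spots and p₀ is the first car's preference.
    carWeight : List ℕ → ℕ → ℕ → ℕ
    carWeight occ p₀ a = x ^ [ a ∈ᵇ occ ] * y ^ [ a ≡ᵇ p₀ ]

    weight : List ℕ → ℕ → List ℕ → ℕ
    weight occ p₀ π = x ^ unlCirc occ π * y ^ countᵇ (λ a → a ≡ᵇ p₀) π

    weight-∷ : ∀ occ p₀ a π → weight occ p₀ (a ∷ π) ≡ carWeight occ p₀ a * weight (parkCirc occ a N ∷ occ) p₀ π
    weight-∷ occ p₀ a π
      rewrite countᵇ-∷ (λ b → b ≡ᵇ p₀) a π
            | ^-distribˡ-+-* x [ a ∈ᵇ occ ] (unlCirc (parkCirc occ a N ∷ occ) π)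
            | ^-distribˡ-+-* y [ a ≡ᵇ p₀ ] (countᵇ (λ b → b ≡ᵇ p₀) π) =
      *-interchange (x ^ [ a ∈ᵇ occ ]) (x ^ unlCirc (parkCirc occ a N ∷ occ) π) (y ^ [ a ≡ᵇ p₀ ]) (y ^ countᵇ (λ b → b ≡ᵇ p₀) π)

    ∑-y^[≡]-absent : ∀ p₀ L → (p₀ ∈ᵇ L) ≡ false → ∑ (λ a → y ^ [ a ≡ᵇ p₀ ]) L ≡ length L
    ∑-y^[≡]-absent p₀ [] _ = refl
    ∑-y^[≡]-absent p₀ (t ∷ L) p₀∉ rewrite ≡ᵇ-sym t p₀ with p₀ ≡ᵇ t
    ∑-y^[≡]-absent p₀ (t ∷ L) () | true
    ... | false = cong suc (∑-y^[≡]-absent p₀ L p₀∉)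

    ∑-y^[≡]-present : ∀ p₀ L → Distinct L → (p₀ ∈ᵇ L) ≡ true → ∑ (λ a → y ^ [ a ≡ᵇ p₀ ]) L + 1 ≡ y + length L
    ∑-y^[≡]-present p₀ (t ∷ L) (t∉L , d) p₀∈ rewrite ≡ᵇ-sym t p₀ with p₀ ≡ᵇ t in p₀≡ᵇt
    ... | true rewrite ∑-y^[≡]-absent p₀ L (subst (λ z → (z ∈ᵇ L) ≡ false) (sym (≡ᵇ≡true⇒≡ p₀≡ᵇt)) t∉L)
      = trans (+-assoc (y * 1) (length L) 1) (cong₂ _+_ (*-identityʳ y) (+-comm (length L) 1))
    ... | false = trans (cong suc (∑-y^[≡]-present p₀ L d p₀∈)) (sym (+-suc y (length L)))

    ∑-carWeight : ∀ occ p₀ → Distinct occ → All (InRange N) occ → (p₀ ∈ᵇ occ) ≡ true → length occ ≤ N →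
      ∑ (carWeight occ p₀) (interval 1 N) ≡ factor (length occ)
    ∑-carWeight occ p₀ d r p₀∈ i≤N = +-cancelʳ-≡ i _ _ (begin
      ∑ (carWeight occ p₀) (interval 1 N) + i        ≡⟨ cong (_+ i) (∑-ext (interval 1 N) selects) ⟩
      ∑ G (interval 1 N) + i                         ≡⟨ cong (∑ G (interval 1 N) +_) (∑-one occ) ⟨
      ∑ G (interval 1 N) + ∑ (λ _ → 1) occ           ≡⟨ ∑-select h (λ _ → 1) (interval 1 N) occ d (All.map (λ {t} → count≡-range t) r) ⟩
      ∑ h occ + ∑ (λ _ → 1) (interval 1 N)           ≡⟨ cong₂ _+_ (∑-*ˡ x (λ a → y ^ [ a ≡ᵇ p₀ ]) occ) (trans (∑-one (interval 1 N)) (length-interval 1 N)) ⟩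
      x * ∑ (λ a → y ^ [ a ≡ᵇ p₀ ]) occ + N          ≡⟨ cong₂ (λ z w → x * z + w) ∑y (sym (m∸n+n≡m i≤N)) ⟩
      x * (y + (i ∸ 1)) + ((N ∸ i) + i)              ≡⟨ expand x y (i ∸ 1) (N ∸ i) i ⟩
      factor i + i                                   ∎)
      where
      open ≡-Reasoning
      i : ℕ
      i = length occ
      expand : ∀ x y a b i → x * (y + a) + (b + i) ≡ x * y + a * x + b + i
      expand = solve-∀
      h : ℕ → ℕ
      h a = x * y ^ [ a ≡ᵇ p₀ ]
      G : ℕ → ℕ
      G a = if a ∈ᵇ occ then h a else 1
      selects : ∀ a → carWeight occ p₀ a ≡ G a
      selects a with a ∈ᵇ occ in a∈
      ... | true = cong (_* y ^ [ a ≡ᵇ p₀ ]) (*-identityʳ x)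
      ... | false with a ≡ᵇ p₀ in a≡ᵇp₀
      ...   | false = refl
      ...   | true with () ← trans (sym a∈) (subst (λ z → (z ∈ᵇ occ) ≡ true) (sym (≡ᵇ≡true⇒≡ a≡ᵇp₀)) p₀∈)
      ∑y : ∑ (λ a → y ^ [ a ≡ᵇ p₀ ]) occ ≡ y + (i ∸ 1)
      ∑y = +-cancelʳ-≡ 1 _ _ (trans (∑-y^[≡]-present p₀ occ d p₀∈)
             (trans (cong (y +_) (sym (m∸n+n≡m (nonempty occ p₀∈)))) (sym (+-assoc y (i ∸ 1) 1))))

    ∑-weight : ∀ m occ p₀ → Distinct occ → All (InRange N) occ → (p₀ ∈ᵇ occ) ≡ true → length occ + m ≤ suc N →
      ∑ (weight occ p₀) (seqs m N) ≡ product (map factor (interval (length occ) m))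
    ∑-weight-parked : ∀ m occ p₀ a → Distinct occ → All (InRange N) occ → (p₀ ∈ᵇ occ) ≡ true → InRange N a →
      length occ + suc m ≤ suc N →
      ∑ (weight (parkCirc occ a N ∷ occ) p₀) (seqs m N) ≡ product (map factor (interval (suc (length occ)) m))

    ∑-weight-parked zero occ p₀ a d r p₀∈ ra le = refl
    ∑-weight-parked (suc m) occ p₀ a d r p₀∈ ra le =
      ∑-weight (suc m) (parkCirc occ a N ∷ occ) p₀ (parked-free , d) (parkCirc-InRange occ a N ra ∷ r)
        (∈ᵇ-there p₀ _ occ p₀∈) (subst (_≤ suc N) (+-suc (length occ) (suc m)) le)
      where
      i<N : length occ < N
      i<N = <-≤-trans (m<m+n (length occ) (s≤s z≤n)) (≤-pred (subst (_≤ suc N) (+-suc (length occ) (suc m)) le))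
      parked-free : (parkCirc occ a N ∈ᵇ occ) ≡ false
      parked-free = parkCirc-free occ a ra (free-spot occ d r i<N)

    ∑-weight zero occ p₀ d r p₀∈ le = refl
    ∑-weight (suc m) occ p₀ d r p₀∈ le = begin
      ∑ (weight occ p₀) (seqs (suc m) N)                                        ≡⟨ ∑-seqs-suc (weight occ p₀) m N ⟩
      ∑ (λ a → ∑ (λ π → weight occ p₀ (a ∷ π)) (seqs m N)) (applyUpTo suc N)    ≡⟨ ∑-range-cong N first-car ⟩
      ∑ (λ a → carWeight occ p₀ a * P) (applyUpTo suc N)                        ≡⟨ ∑-*ʳ P (carWeight occ p₀) (applyUpTo suc N) ⟩
      ∑ (carWeight occ p₀) (applyUpTo suc N) * P                                ≡⟨ cong (λ L → ∑ (carWeight occ p₀) L * P) (range≡interval N) ⟩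
      ∑ (carWeight occ p₀) (interval 1 N) * P                                   ≡⟨ cong (_* P) (∑-carWeight occ p₀ d r p₀∈ i≤N) ⟩
      factor (length occ) * P                                                   ∎
      where
      open ≡-Reasoning
      P : ℕ
      P = product (map factor (interval (suc (length occ)) m))
      i≤N : length occ ≤ N
      i≤N = ≤-pred (<-≤-trans (m<m+n (length occ) (s≤s z≤n)) le)
      first-car : ∀ a → InRange N a → ∑ (λ π → weight occ p₀ (a ∷ π)) (seqs m N) ≡ carWeight occ p₀ a * P
      first-car a ra = trans (∑-ext (seqs m N) (weight-∷ occ p₀ a)) (trans (∑-*ˡ (carWeight occ p₀ a) _ (seqs m N))
                         (cong (carWeight occ p₀ a *_) (∑-weight-parked m occ p₀ a d r p₀∈ ra le)))

  freeIn : List ℕ → ℕ → ℕ → ℕ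
  freeIn occ j zero = 0
  freeIn occ j (suc k) = [ not (j ∈ᵇ occ) ] + freeIn occ (suc j) k

  freeFrom : List ℕ → ℕ → ℕ
  freeFrom occ j = freeIn occ j (suc N ∸ j)

  freeFrom-unfold : ∀ occ j → j ≤ N → freeFrom occ j ≡ [ not (j ∈ᵇ occ) ] + freeFrom occ (suc j)
  freeFrom-unfold occ j j≤N rewrite +-∸-assoc 1 j≤N = refl

  freeIn-[] : ∀ j k → freeIn [] j k ≡ k
  freeIn-[] j zero = refl
  freeIn-[] j (suc k) = cong suc (freeIn-[] (suc j) k)

  freeIn-park : ∀ k j occ s → j + k ≡ suc N → (s ∈ᵇ occ) ≡ false → s ≤ N →
    freeIn occ j k ≡ freeIn (s ∷ occ) j k + [ j ≤ᵇ s ]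
  freeIn-park zero j occ s e _ s≤N
    rewrite >⇒≤ᵇ≡false {j} {s} (subst (s <_) (trans (sym e) (+-identityʳ j)) (s≤s s≤N)) = refl
  freeIn-park (suc k) j occ s e s∉occ s≤N with j ≟ s
  ... | yes refl rewrite s∉occ | ≡ᵇ-refl j | ≤⇒≤ᵇ≡true (≤-refl {j})
                       | freeIn-park k (suc j) occ j (trans (sym (+-suc j k)) e) s∉occ s≤N | >⇒≤ᵇ≡false {suc j} {j} ≤-refl =
    trans (+-identityʳ _) (+-comm 1 _)
  ... | no j≢s rewrite ≢⇒≡ᵇ≡false j≢s | freeIn-park k (suc j) occ s (trans (sym (+-suc j k)) e) s∉occ s≤N =
    trans (sym (+-assoc [ not (j ∈ᵇ occ) ] _ _)) (cong ([ not (j ∈ᵇ occ) ] + freeIn (s ∷ occ) (suc j) k +_) [1+j≤ᵇs]≡[j≤ᵇs])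
    where
    [1+j≤ᵇs]≡[j≤ᵇs] : [ suc j ≤ᵇ s ] ≡ [ j ≤ᵇ s ]
    [1+j≤ᵇs]≡[j≤ᵇs] with j <? s
    ... | yes j<s rewrite ≤⇒≤ᵇ≡true j<s | ≤⇒≤ᵇ≡true (<⇒≤ j<s) = refl
    ... | no j≮s rewrite ≰⇒≤ᵇ≡false j≮s | ≰⇒≤ᵇ≡false {j} {s} (λ j≤s → j≮s (≤∧≢⇒< j≤s j≢s)) = refl

  freeFrom-park : ∀ j occ s → j ≤ suc N → (s ∈ᵇ occ) ≡ false → s ≤ N → freeFrom occ j ≡ freeFrom (s ∷ occ) j + [ j ≤ᵇ s ]
  freeFrom-park j occ s j≤N+1 = freeIn-park (suc N ∸ j) j occ s (m+[n∸m]≡n j≤N+1)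

  freeFrom-skip : ∀ d a occ → a + d ≤ suc N → (∀ u → a ≤ u → u < a + d → (u ∈ᵇ occ) ≡ true) →
    freeFrom occ a ≡ freeFrom occ (a + d)
  freeFrom-skip zero a occ _ _ = cong (freeFrom occ) (sym (+-identityʳ a))
  freeFrom-skip (suc d) a occ le occupied = begin
    freeFrom occ a                                  ≡⟨ freeFrom-unfold occ a (≤-pred (≤-trans (m<m+n a (s≤s z≤n)) le)) ⟩
    [ not (a ∈ᵇ occ) ] + freeFrom occ (suc a)       ≡⟨ cong (λ b → [ not b ] + freeFrom occ (suc a)) (occupied a ≤-refl (m<m+n a (s≤s z≤n))) ⟩
    freeFrom occ (suc a)                            ≡⟨ freeFrom-skip d (suc a) occ (subst (_≤ suc N) (+-suc a d) le)
                                                         (λ u a<u u<a+d → occupied u (<⇒≤ a<u) (subst (u <_) (sym (+-suc a d)) u<a+d)) ⟩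
    freeFrom occ (suc a + d)                        ≡⟨ cong (freeFrom occ) (+-suc a d) ⟨
    freeFrom occ (a + suc d)                        ∎
    where open ≡-Reasoning

  freeIn-positive : ∀ k j occ → 1 ≤ freeIn occ j k → ∃ λ t → j ≤ t × t < j + k × (t ∈ᵇ occ) ≡ false
  freeIn-positive (suc k) j occ h with j ∈ᵇ occ in j∈occ
  ... | false = j , ≤-refl , m<m+n j (s≤s z≤n) , j∈occ
  ... | true with freeIn-positive k (suc j) occ h
  ...   | t , j<t , t<j+1+k , t∉occ = t , <⇒≤ j<t , subst (t <_) (sym (+-suc j k)) t<j+1+k , t∉occ

  record FirstFree (occ : List ℕ) (a d : ℕ) : Set where
    field
      spot       : ℕ
      a≤spot     : a ≤ spot
      spot≤N     : spot ≤ N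
      spot-free  : (spot ∈ᵇ occ) ≡ false
      before-occupied : ∀ u → a ≤ u → u < spot → (u ∈ᵇ occ) ≡ true
      parkCirc≡  : ∀ f → d < f → parkCirc occ a f ≡ spot
      firstFree≡ : ∀ M g → N ≤ M → d < g → firstFree M g occ a ≡ spot

  first-free : ∀ d a occ → a + d ≤ N → ((a + d) ∈ᵇ occ) ≡ false → FirstFree occ a d
  first-free d a occ le e with a ∈ᵇ occ in a∈occ
  ... | false = record
    { spot = a ; a≤spot = ≤-refl ; spot≤N = a≤N ; spot-free = a∈occ
    ; before-occupied = λ u a≤u u<a → ⊥-elim (<⇒≱ u<a a≤u) ; parkCirc≡ = parks ; firstFree≡ = finds }
    where
    a≤N : a ≤ N
    a≤N = ≤-trans (m≤m+n a d) le
    parks : ∀ f → d < f → parkCirc occ a f ≡ a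
    parks (suc f) _ rewrite a∈occ = refl
    finds : ∀ M g → N ≤ M → d < g → firstFree M g occ a ≡ a
    finds M (suc g) N≤M _ rewrite ≤⇒≤ᵇ≡true (≤-trans a≤N N≤M) | a∈occ = refl
  first-free zero a occ le e | true with () ← trans (sym a∈occ) (trans (cong (_∈ᵇ occ) (sym (+-identityʳ a))) e)
  first-free (suc d) a occ le e | true = record
    { spot = spot ; a≤spot = ≤-trans (n≤1+n a) a≤spot ; spot≤N = spot≤N ; spot-free = spot-free
    ; before-occupied = before ; parkCirc≡ = parks ; firstFree≡ = finds }
    where
    a<N : a < N
    a<N = ≤-trans (m<m+n a (s≤s z≤n)) le
    open FirstFree (first-free d (suc a) occ (subst (_≤ N) (+-suc a d) le) (trans (cong (_∈ᵇ occ) (sym (+-suc a d))) e))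
    before : ∀ u → a ≤ u → u < spot → (u ∈ᵇ occ) ≡ true
    before u a≤u u<spot with a ≟ u
    ... | yes refl = a∈occ
    ... | no a≢u = before-occupied u (≤∧≢⇒< a≤u a≢u) u<spot
    parks : ∀ f → suc d < f → parkCirc occ a f ≡ spot
    parks (suc f) (s≤s d<f) rewrite a∈occ | next-< a a<N = parkCirc≡ f d<f
    finds : ∀ M g → N ≤ M → suc d < g → firstFree M g occ a ≡ spot
    finds M (suc g) N≤M (s≤s d<g) rewrite ≤⇒≤ᵇ≡true (≤-trans (<⇒≤ a<N) N≤M) | a∈occ = firstFree≡ M g N≤M d<g

  -- Enough free spots in every [j, N] for the cars still to come: then each of them
  -- parks in [its preference, N], where the classical and circular protocols agree.
  Room : List ℕ → List ℕ → Set
  Room occ cars = ∀ j → 1 ≤ j → j ≤ N → #≥ cars j ≤ freeFrom occ j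

  room-after-park : ∀ a cars occ s → InRange N a → Room occ (a ∷ cars) → a ≤ s → s ≤ N → (s ∈ᵇ occ) ≡ false →
    (∀ u → a ≤ u → u < s → (u ∈ᵇ occ) ≡ true) → Room (s ∷ occ) cars
  room-after-park a cars occ s (1≤a , a≤N) room a≤s s≤N s∉occ occupied j 1≤j j≤N
    with freeFrom-park j occ s (≤-trans j≤N (n≤1+n N)) s∉occ s≤N | room j 1≤j j≤N
  ... | park | room-j rewrite countᵇ-∷ (j ≤ᵇ_) a cars with j ≤? a
  ...   | yes j≤a rewrite ≤⇒≤ᵇ≡true j≤a | ≤⇒≤ᵇ≡true (≤-trans j≤a a≤s) = m<n+1⇒m≤n (subst (_ <_) park room-j)
  ...   | no j≰a rewrite ≰⇒≤ᵇ≡false j≰a with j ≤? s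
  ...     | no j≰s rewrite ≰⇒≤ᵇ≡false j≰s = subst (#≥ cars j ≤_) (trans park (+-identityʳ _)) room-j
  ...     | yes j≤s rewrite ≤⇒≤ᵇ≡true j≤s = m<n+1⇒m≤n (subst (_ <_) park (≤-trans (s≤s (#≥-mono a j cars a≤j)) room-a))
    where
    a≤j : a ≤ j
    a≤j = <⇒≤ (≰⇒> j≰a)
    skip : freeFrom occ a ≡ freeFrom occ j
    skip = trans (freeFrom-skip (j ∸ a) a occ (subst (_≤ suc N) (sym (m+[n∸m]≡n a≤j)) (≤-trans j≤N (n≤1+n N)))
                   (λ u a≤u u<a+d → occupied u a≤u (≤-trans u<a+d (≤-trans (≤-reflexive (m+[n∸m]≡n a≤j)) j≤s))))
                 (cong (freeFrom occ) (m+[n∸m]≡n a≤j))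
    room-a : suc (#≥ cars a) ≤ freeFrom occ j
    room-a = subst₂ _≤_ (#≥-self a cars) skip (room a 1≤a a≤N)

  unlAux≡unlCirc : ∀ cars l occ → All (InRange N) (cars ∷ʳ l) → Room occ cars →
    unlAux (suc N) occ (cars ∷ʳ l) ≡ unlCirc occ (cars ∷ʳ l)
  unlAux≡unlCirc [] l occ ((1≤l , l≤N) ∷ []) _ =
    cong (_+ 0) (firstFree-misses (suc N) (suc N) occ l 1≤l (≤-trans l≤N (n≤1+n N)))
  unlAux≡unlCirc (a ∷ cars) l occ ((1≤a , a≤N) ∷ rs) room
    with freeIn-positive (suc N ∸ a) a occ (≤-trans (subst (1 ≤_) (sym (#≥-self a cars)) (s≤s z≤n)) (room a 1≤a a≤N))
  ... | t , a≤t , t<a+k , t∉occ = begin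
    unlAux (suc N) occ (a ∷ rest)
      ≡⟨ cong₂ _+_ (firstFree-misses (suc N) (suc N) occ a 1≤a (≤-trans a≤N (n≤1+n N)))
                   (cong (λ z → unlAux (suc N) (z ∷ occ) rest) ff≡spot) ⟩
    [ a ∈ᵇ occ ] + unlAux (suc N) (spot ∷ occ) rest
      ≡⟨ cong ([ a ∈ᵇ occ ] +_) (unlAux≡unlCirc cars l (spot ∷ occ) rs
           (room-after-park a cars occ spot (1≤a , a≤N) room a≤spot spot≤N spot-free before-occupied)) ⟩
    [ a ∈ᵇ occ ] + unlCirc (spot ∷ occ) rest
      ≡⟨ cong (λ z → [ a ∈ᵇ occ ] + unlCirc (z ∷ occ) rest) (parkCirc≡ N d<N) ⟨
    unlCirc occ (a ∷ rest) ∎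
    where
    open ≡-Reasoning
    rest : List ℕ
    rest = cars ∷ʳ l
    t≤N : t ≤ N
    t≤N = ≤-pred (subst (t <_) (m+[n∸m]≡n (≤-trans a≤N (n≤1+n N))) t<a+k)
    a+d≡t : a + (t ∸ a) ≡ t
    a+d≡t = m+[n∸m]≡n a≤t
    d<N : t ∸ a < N
    d<N = ≤-trans (+-monoˡ-≤ (t ∸ a) 1≤a) (≤-trans (≤-reflexive a+d≡t) t≤N)
    open FirstFree (first-free (t ∸ a) a occ (subst (_≤ N) (sym a+d≡t) t≤N) (trans (cong (_∈ᵇ occ) a+d≡t) t∉occ))
    ff≡spot : firstFree (suc N) (suc (suc N)) occ a ≡ spot
    ff≡spot = firstFree≡ (suc N) (suc (suc N)) (n≤1+n N) (≤-trans d<N (≤-trans (n≤1+n N) (n≤1+n (suc N))))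

  prime⇒room : ∀ cars l → length (cars ∷ʳ l) ≡ suc N → isPrime (cars ∷ʳ l) ≡ true → Room [] cars
  prime⇒room cars l len prime (suc zero) _ _ =
    subst (#≥ cars 1 ≤_) (sym (freeIn-[] 1 N)) (subst (#≥ cars 1 ≤_) |cars|≡N (countᵇ≤length _ cars))
    where
    |cars|≡N : length cars ≡ N
    |cars|≡N = +-cancelʳ-≡ 1 _ _ (trans (sym (length-++ cars)) (trans len (+-comm 1 N)))
  prime⇒room cars l len prime (suc (suc j)) _ j+2≤N = subst (#≥ cars (2 + j) ≤_) (sym (freeIn-[] (2 + j) (N ∸ suc j))) (begin
    #≥ cars (2 + j)        ≤⟨ m≤m+n _ _ ⟩
    #≥ cars (2 + j) + #≥ (l ∷ []) (2 + j) ≡⟨ countᵇ-++ _ cars (l ∷ []) ⟨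
    #≥ π (2 + j)           ≤⟨ m+n≤o⇒m≤o∸n (#≥ π (2 + j)) (≤-trans (+-monoʳ-≤ (#≥ π (2 + j)) prime-j) (≤-reflexive complement)) ⟩
    suc N ∸ (2 + j)        ∎)
    where
    open ≤-Reasoning
    π : List ℕ
    π = cars ∷ʳ l
    prime-j : 2 + j ≤ #≤ π (suc j)
    prime-j = isPrime⇒PrimeCounts N π len prime (suc j) (s≤s z≤n) (≤-trans (n≤1+n (suc j)) j+2≤N)
    complement : #≥ π (2 + j) + #≤ π (suc j) ≡ suc N
    complement = trans (+-comm _ (#≤ π (suc j))) (trans (#≤+#≥≡length (suc j) π) len)

  unl≡unlCirc : ∀ π → All (InRange N) π → length π ≡ suc N → isPrime π ≡ true → unl π ≡ unlCirc [] π
  unl≡unlCirc π r len prime with initLast π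
  unl≡unlCirc .[] r () prime | []
  ... | cars ∷ʳ′ l = trans (cong (λ n → unlAux n [] (cars ∷ʳ l)) len)
                          (unlAux≡unlCirc cars l [] r (prime⇒room cars l len prime))

  rotate-≤-low : ∀ k m i → m + k ≡ N → i ≤ m → ∀ v → InRange N v →
    [ rotate k v ≤ᵇ i + k ] + [ v ≤ᵇ m ] ≡ [ v ≤ᵇ i ] + 1
  rotate-≤-low k m i e i≤m v rv rewrite rotate-wrap k m e v rv with v ≤? m
  ... | yes v≤m rewrite ≤⇒≤ᵇ≡true v≤m with v ≤? i
  ...   | yes v≤i rewrite ≤⇒≤ᵇ≡true v≤i | ≤⇒≤ᵇ≡true (+-monoˡ-≤ k v≤i) = refl
  ...   | no v≰i rewrite ≰⇒≤ᵇ≡false v≰i | ≰⇒≤ᵇ≡false {v + k} {i + k} (λ h → v≰i (+-cancelʳ-≤ k v i h)) = refl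
  rotate-≤-low k m i e i≤m v rv | no v≰m
    rewrite ≰⇒≤ᵇ≡false v≰m | ≰⇒≤ᵇ≡false {v} {i} (λ v≤i → v≰m (≤-trans v≤i i≤m))
          | ≤⇒≤ᵇ≡true {v ∸ m} {i + k} (≤-trans (m≤n+o⇒m∸n≤o v m (subst (v ≤_) (sym e) (proj₂ rv))) (m≤n+m k i)) = refl

  rotate-≤-wrapped : ∀ k m j → m + k ≡ N → j < k → ∀ v → InRange N v →
    [ rotate k v ≤ᵇ j ] + [ v ≤ᵇ m ] ≡ [ v ≤ᵇ m + j ] + 0
  rotate-≤-wrapped k m j e j<k v rv rewrite rotate-wrap k m e v rv with v ≤? m
  ... | yes v≤m rewrite ≤⇒≤ᵇ≡true v≤m | >⇒≤ᵇ≡false {v + k} {j} (≤-trans j<k (m≤n+m k v)) | ≤⇒≤ᵇ≡true (≤-trans v≤m (m≤m+n m j)) = refl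
  ... | no v≰m rewrite ≰⇒≤ᵇ≡false v≰m with v ≤? m + j
  ...   | yes v≤m+j rewrite ≤⇒≤ᵇ≡true v≤m+j | ≤⇒≤ᵇ≡true {v ∸ m} {j} (m≤n+o⇒m∸n≤o v m v≤m+j) = refl
  ...   | no v≰m+j rewrite ≰⇒≤ᵇ≡false v≰m+j
    | ≰⇒≤ᵇ≡false {v ∸ m} {j} (λ h → v≰m+j (subst (_≤ m + j) (m+[n∸m]≡n (<⇒≤ (≰⇒> v≰m))) (+-monoʳ-≤ m h))) = refl

  #≤-rotate-low : ∀ π k m i → All (InRange N) π → length π ≡ suc N → m + k ≡ N → i ≤ m →
    #≤ (map (rotate k) π) (i + k) + #≤ π m ≡ #≤ π i + suc N
  #≤-rotate-low π k m i r l e i≤m =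
    trans (countᵇ-map-+ (rotate k) (_≤ᵇ (i + k)) (_≤ᵇ m) (_≤ᵇ i) (InRange N) 1 π r (rotate-≤-low k m i e i≤m))
          (cong (#≤ π i +_) (trans (*-identityʳ (length π)) l))

  #≤-rotate-wrapped : ∀ π k m j → All (InRange N) π → m + k ≡ N → j < k →
    #≤ (map (rotate k) π) j + #≤ π m ≡ #≤ π (m + j)
  #≤-rotate-wrapped π k m j r e j<k =
    trans (countᵇ-map-+ (rotate k) (_≤ᵇ j) (_≤ᵇ m) (_≤ᵇ (m + j)) (InRange N) 0 π r (rotate-≤-wrapped k m j e j<k))
          (trans (cong (#≤ π (m + j) +_) (*-zeroʳ (length π))) (+-identityʳ _))

  prime-rotation⇒lastArgmin : ∀ π k m → All (InRange N) π → length π ≡ suc N → 1 ≤ k → m + k ≡ N →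
    PrimeCounts N (map (rotate k) π) → LastArgmin (#≤ π) N m
  prime-rotation⇒lastArgmin π k m r l 1≤k e prime = minimal , strictly-after
    where
    minimal : ∀ i → i ≤ m → #≤ π m + i ≤ #≤ π i + m
    minimal i i≤m = +-cancelʳ-≤ (suc k) _ _ (subst₂ _≤_ (lhs i k (#≤ π m)) (trans (cong (λ z → #≤ π i + suc z) (sym e)) (rhs (#≤ π i) m k))
      (≤-trans (+-monoˡ-≤ (#≤ π m) (prime (i + k) (≤-trans 1≤k (m≤n+m k i)) (subst (i + k ≤_) e (+-monoˡ-≤ k i≤m))))
               (≤-reflexive (#≤-rotate-low π k m i r l e i≤m))))
      where
      lhs : ∀ i k cm → suc (i + k) + cm ≡ (cm + i) + suc k
      lhs = solve-∀
      rhs : ∀ ci m k → ci + suc (m + k) ≡ (ci + m) + suc k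
      rhs = solve-∀
    strictly-after : ∀ t → m < t → t < N → #≤ π m + t < #≤ π t + m
    strictly-after t m<t t<N = subst (λ z → #≤ π m + z < #≤ π z + m) m+j≡t
      (subst (_≤ #≤ π (m + j) + m) (shuffle (#≤ π m) m j)
        (+-monoˡ-≤ m (≤-trans (+-monoˡ-≤ (#≤ π m) (prime j 1≤j j≤N)) (≤-reflexive (#≤-rotate-wrapped π k m j r e j<k)))))
      where
      j : ℕ
      j = t ∸ m
      m+j≡t : m + j ≡ t
      m+j≡t = m+[n∸m]≡n (<⇒≤ m<t)
      1≤j : 1 ≤ j
      1≤j = m<n⇒0<n∸m m<t
      j≤N : j ≤ N
      j≤N = ≤-trans (m≤n+m j m) (≤-trans (≤-reflexive m+j≡t) (<⇒≤ t<N))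
      j<k : j < k
      j<k = +-cancelˡ-< m j k (subst₂ _<_ (sym m+j≡t) (sym e) t<N)
      shuffle : ∀ cm m j → suc j + cm + m ≡ suc (cm + (m + j))
      shuffle = solve-∀

  lastArgmin⇒prime-rotation : ∀ π k m → All (InRange N) π → length π ≡ suc N → m + k ≡ N →
    LastArgmin (#≤ π) N m → PrimeCounts N (map (rotate k) π)
  lastArgmin⇒prime-rotation π k m r l e (minimal , after) j 1≤j j≤N with k ≤? j
  ... | yes k≤j = subst (λ z → suc z ≤ #≤ (map (rotate k) π) z) i+k≡j
        (+-cancelʳ-≤ (#≤ π m) _ _ (subst₂ _≤_ (lhs i k (#≤ π m))
          (sym (trans (#≤-rotate-low π k m i r l e i≤m) (trans (cong (λ z → #≤ π i + suc z) (sym e)) (rhs (#≤ π i) m k))))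
          (+-monoˡ-≤ (suc k) (minimal i i≤m))))
    where
    i : ℕ
    i = j ∸ k
    i+k≡j : i + k ≡ j
    i+k≡j = m∸n+n≡m k≤j
    i≤m : i ≤ m
    i≤m = +-cancelʳ-≤ k i m (subst₂ _≤_ (sym i+k≡j) (sym e) j≤N)
    lhs : ∀ i k cm → (cm + i) + suc k ≡ suc (i + k) + cm
    lhs = solve-∀
    rhs : ∀ ci m k → ci + suc (m + k) ≡ (ci + m) + suc k
    rhs = solve-∀
  ... | no k≰j = +-cancelʳ-≤ (#≤ π m + m) _ _ (subst₂ _≤_ (lhs (#≤ π m) m j) (rhs (#≤ (map (rotate k) π) j) (#≤ π m) m)
      (subst (λ z → suc (#≤ π m + (m + j)) ≤ z + m) (sym (#≤-rotate-wrapped π k m j r e j<k))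
        (after (m + j) (subst (_≤ m + j) (+-comm m 1) (+-monoʳ-≤ m 1≤j)) (subst (m + j <_) e (+-monoʳ-< m j<k)))))
    where
    j<k : j < k
    j<k = ≰⇒> k≰j
    lhs : ∀ cm m j → suc (cm + (m + j)) ≡ suc j + (cm + m)
    lhs = solve-∀
    rhs : ∀ cs cm m → cs + cm + m ≡ cs + (cm + m)
    rhs = solve-∀

  one-prime-rotation : ∀ π → All (InRange N) π → length π ≡ suc N →
    ∑ (λ k → [ isPrime (map (rotate k) π) ]) (applyUpTo suc N) ≡ 1
  one-prime-rotation π r l = trans (cong (∑ (λ k → [ isPrime (map (rotate k) π) ])) (range≡interval N))
    (∑-interval-unique _ 1 N exists unique)
    where
    length-rotated : ∀ k → length (map (rotate k) π) ≡ suc N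
    length-rotated k = trans (length-map (rotate k) π) l
    N∸k<N : ∀ {k} → 1 ≤ k → k < 1 + N → N ∸ k < N
    N∸k<N 1≤k k<1+N = ∸-monoʳ-< 1≤k (≤-pred k<1+N)
    exists : ∃ λ k → 1 ≤ k × k < 1 + N × isPrime (map (rotate k) π) ≡ true
    exists with lastArgmin-exists (#≤ π) N (s≤s z≤n)
    ... | m , m<N , argmin = N ∸ m , m<n⇒0<n∸m m<N , s≤s (m∸n≤m N m) ,
      PrimeCounts⇒isPrime N (map (rotate (N ∸ m)) π) (length-rotated (N ∸ m)) (lastArgmin⇒prime-rotation π (N ∸ m) m r l (m+[n∸m]≡n (<⇒≤ m<N)) argmin)
    argmin : ∀ {k} → 1 ≤ k → k < 1 + N → isPrime (map (rotate k) π) ≡ true → LastArgmin (#≤ π) N (N ∸ k)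
    argmin {k} 1≤k k<1+N prime = prime-rotation⇒lastArgmin π k (N ∸ k) r l 1≤k (m∸n+n≡m (≤-pred k<1+N))
      (isPrime⇒PrimeCounts N (map (rotate k) π) (length-rotated k) prime)
    unique : ∀ k k′ → k < 1 + N → k′ < 1 + N → 1 ≤ k → 1 ≤ k′ →
      isPrime (map (rotate k) π) ≡ true → isPrime (map (rotate k′) π) ≡ true → k ≡ k′
    unique k k′ k< k′< 1≤k 1≤k′ pk pk′ = ∸-cancelˡ-≡ (≤-pred k<) (≤-pred k′<)
      (lastArgmin-unique (#≤ π) N (N∸k<N 1≤k k<) (N∸k<N 1≤k′ k′<) (argmin 1≤k k< pk) (argmin 1≤k′ k′< pk′))

  module Count (x y : ℕ) where
    open Weights x y

    w : List ℕ → ℕ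
    w π = x ^ unl π * y ^ lel π

    wCirc : List ℕ → ℕ
    wCirc π = x ^ unlCirc [] π * y ^ lel π

    wPrime : List ℕ → ℕ
    wPrime π = [ isPrime π ] * wCirc π

    ∑-PPF : ∑ w (PPF (suc N)) ≡ ∑ wPrime (seqs (suc N) N)
    ∑-PPF = trans (∑-filterᵇ w isPPF (seqs (suc N) (suc N)))
              (trans (∑-seqs-restrict (suc N) N _ no-N+1) (∑-seqs-cong (suc N) N circular))
      where
      no-N+1 : ∀ π → length π ≡ suc N → (suc N ∈ᵇ π) ≡ true → (if isPPF π then w π else 0) ≡ 0
      no-N+1 π l N+1∈π with isPrime π in prime
      ... | true = ⊥-elim (<⇒≱ (subst (#≤ π N <_) l (∈ᵇ⇒#≤<length (suc N) N π N+1∈π ≤-refl))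
                                (isPrime⇒PrimeCounts N π l prime N (s≤s z≤n) ≤-refl))
      ... | false rewrite ∧-zeroʳ (isParkingFunction π) = refl
      circular : ∀ π → All (InRange N) π → length π ≡ suc N → (if isPPF π then w π else 0) ≡ wPrime π
      circular π r l with isPrime π in prime
      ... | true rewrite prime⇒parking N π r l prime =
        trans (cong (λ u → x ^ u * y ^ lel π) (unl≡unlCirc π r l prime)) (sym (+-identityʳ _))
      ... | false rewrite ∧-zeroʳ (isParkingFunction π) = refl

    ∑-rotations : N * ∑ wPrime (seqs (suc N) N) ≡ ∑ wCirc (seqs (suc N) N)
    ∑-rotations = begin
      N * total                                                          ≡⟨ cong (_* total) (length-applyUpTo suc N) ⟨
      length (applyUpTo suc N) * total                                   ≡⟨ ∑-const total (applyUpTo suc N) ⟨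
      ∑ (λ k → total) (applyUpTo suc N)                                  ≡⟨ ∑-ext (applyUpTo suc N) rotated ⟩
      ∑ (λ k → ∑ (λ π → [ prime k π ] * wCirc π) (seqs (suc N) N)) (applyUpTo suc N)
        ≡⟨ ∑-comm (λ k π → [ prime k π ] * wCirc π) (applyUpTo suc N) (seqs (suc N) N) ⟩
      ∑ (λ π → ∑ (λ k → [ prime k π ] * wCirc π) (applyUpTo suc N)) (seqs (suc N) N)
        ≡⟨ ∑-seqs-cong (suc N) N (λ π r l → trans (∑-*ʳ (wCirc π) (λ k → [ prime k π ]) (applyUpTo suc N))
                                              (trans (cong (_* wCirc π) (one-prime-rotation π r l)) (+-identityʳ (wCirc π)))) ⟩
      ∑ wCirc (seqs (suc N) N)                                           ∎
      where
      open ≡-Reasoning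
      total : ℕ
      total = ∑ wPrime (seqs (suc N) N)
      prime : ℕ → List ℕ → Bool
      prime k π = isPrime (map (rotate k) π)
      wCirc-rotate : ∀ k π → All (InRange N) π → wCirc (map (rotate k) π) ≡ wCirc π
      wCirc-rotate k π r = cong₂ (λ u v → x ^ u * y ^ v) (unlCirc-rotate k [] π [] r) (lel-rotate k π r)
      rotated : ∀ k → total ≡ ∑ (λ π → [ prime k π ] * wCirc π) (seqs (suc N) N)
      rotated k = trans (sym (∑-seqs-rotate k (suc N) wPrime))
        (∑-seqs-cong (suc N) N (λ π r _ → cong ([ prime k π ] *_) (wCirc-rotate k π r)))

    ∑-wCirc : ∑ wCirc (seqs (suc N) N) ≡ N * (y * product (map factor (interval 1 N)))
    ∑-wCirc = begin
      ∑ wCirc (seqs (suc N) N)                                                  ≡⟨ ∑-seqs-suc wCirc N N ⟩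
      ∑ (λ a → ∑ (λ π → wCirc (a ∷ π)) (seqs N N)) (applyUpTo suc N)            ≡⟨ ∑-range-cong N first-car ⟩
      ∑ (λ _ → y * P) (applyUpTo suc N)                                         ≡⟨ ∑-const (y * P) (applyUpTo suc N) ⟩
      length (applyUpTo suc N) * (y * P)                                        ≡⟨ cong (_* (y * P)) (length-applyUpTo suc N) ⟩
      N * (y * P)                                                               ∎
      where
      open ≡-Reasoning
      P : ℕ
      P = product (map factor (interval 1 N))
      wCirc-∷ : ∀ a π → wCirc (a ∷ π) ≡ y * weight (a ∷ []) a π
      wCirc-∷ a π rewrite ≡ᵇ-refl a = x*[y*z]≡y*[x*z] (x ^ unlCirc (a ∷ []) π) y (y ^ countᵇ (_≡ᵇ a) π)
      first-car : ∀ a → InRange N a → ∑ (λ π → wCirc (a ∷ π)) (seqs N N) ≡ y * P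
      first-car a ra = trans (∑-ext (seqs N N) (wCirc-∷ a)) (trans (∑-*ˡ y (weight (a ∷ []) a) (seqs N N))
        (cong (y *_) (∑-weight N (a ∷ []) a (refl , _) (ra ∷ []) (∈ᵇ-here a []) ≤-refl)))

    ∑-PPF-closed : ∑ w (PPF (suc N)) ≡ y * product (map factor (interval 1 N))
    ∑-PPF-closed = trans ∑-PPF (*-cancelˡ-≡ _ _ N (trans ∑-rotations ∑-wCirc))

theorem5p4 : (n : ℕ) → n ≥ 1 → (x y : ℕ) →
    sum (map (λ π → x ^ unl π * y ^ lel π) (PPF n))
      ≡ y * product (map (λ i → x * y + (i ∸ 1) * x + (n ∸ 1 ∸ i)) (applyUpTo (λ k → k + 1) (n ∸ 1)))
theorem5p4 (suc zero) _ x y = trans (+-identityʳ (1 * (y * 1))) (*-identityˡ (y * 1))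
theorem5p4 (suc (suc N′)) _ x y =
  trans ∑-PPF-closed (cong (λ L → y * product (map factor L)) (sym (applyUpTo≡interval N (_+ 1) 1 (λ i → +-comm i 1))))
  where
  open Parking N′
  open Weights x y
  open Count x y
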